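{- Suppose that $\det^4_{\mathbb{F}_2}=\sum_{i=1}^r A_i\otimes B_i$, where each $A_i$ and $B_i$ is a rank-$1$ $4\times4$ matrix over $\mathbb{F}_2$, and $r$ is minimal among all such expressions. Let $\mathbf{u},\mathbf{v}\in\mathbb{F}_2^4$ be nonzero vectors (not necessarily distinct). Then the number of indices $i$ with $\mathbf{u}^TA_i\mathbf{v}=1$ is not equal to $1$.
   Context: $\det^4_{\mathbb{F}_2}=\sum_{\sigma\in S_4}\operatorname{sgn}(\sigma)\mathbf{e}_{\sigma(1)}\otimes\mathbf{e}_{\sigma(2)}\otimes\mathbf{e}_{\sigma(3)}\otimes\mathbf{e}_{\sigma(4)}\in(\mathbb{F}_2^4)^{\otimes4}$, regarded via the flattening $(\mathbb{F}_2^4)^{\otimes4}=(\mathbb{F}_2^4)^{\otimes2}\otimes(\mathbb{F}_2^4)^{\otimes2}$ as an element of $M_4(\mathbb{F}_2)\otimes M_4(\mathbb{F}_2)$, where a $4\times4$ matrix $M$ is identified with $\sum_{j,k}M_{j,k}\,\mathbf{e}_j\otimes\mathbf{e}_k$ (so the entry $(j,k)$ of $A_i$ corresponds to the first two tensor factors, and of $B_i$ to the last two). -}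

module Defs where

open import Data.Bool using (Bool; true; false; _∧_; _xor_; not; if_then_else_)
open import Data.Nat using (ℕ; zero; suc; _≤_)
open import Data.Fin using (Fin; zero; suc; _≟_)
open import Data.Product using (Σ; ∃; _×_; _,_; proj₁; proj₂)
open import Relation.Nullary.Decidable using (⌊_⌋)
open import Relation.Binary.PropositionalEquality using (_≡_)

-- The field F₂ is modelled by Bool: addition = xor, multiplication = ∧.
F₂ : Set
F₂ = Bool

-- Vectors in F₂⁴ and 4×4 matrices over F₂ (indices 0..3 stand for 1..4).
Vec4 : Set
Vec4 = Fin 4 → F₂

Mat4 : Set
Mat4 = Fin 4 → Fin 4 → F₂

Σ₂ : (n : ℕ) → (Fin n → F₂) → F₂
Σ₂ zero    f = false
Σ₂ (suc n) f = f zero xor Σ₂ n (λ i → f (suc i))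

count : (n : ℕ) → (Fin n → F₂) → ℕ
count zero    f = zero
count (suc n) f = (if f zero then suc else (λ m → m)) (count n (λ i → f (suc i)))

NonZeroVec : Vec4 → Set
NonZeroVec u = ∃ λ j → u j ≡ true

outer : Vec4 → Vec4 → Mat4
outer x y j k = x j ∧ y k

IsRank1 : Mat4 → Set
IsRank1 M = Σ Vec4 λ x → Σ Vec4 λ y →
  NonZeroVec x × NonZeroVec y × (∀ j k → M j k ≡ outer x y j k)

bil : Vec4 → Mat4 → Vec4 → F₂
bil u M v = Σ₂ 4 λ j → Σ₂ 4 λ k → u j ∧ (M j k ∧ v k)

-- det⁴ over F₂ as a tensor in (F₂⁴)^{⊗4}: the coefficient of
-- e_a ⊗ e_b ⊗ e_c ⊗ e_d is Σ_{σ ∈ S₄, (σ1,σ2,σ3,σ4)=(a,b,c,d)} sgn σ.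
-- Over F₂, sgn σ = 1, and there is exactly one such σ iff a,b,c,d are
-- pairwise distinct (none otherwise), so the coefficient is 1 iff distinct.
distinct4 : Fin 4 → Fin 4 → Fin 4 → Fin 4 → F₂
distinct4 a b c d =
  not ⌊ a ≟ b ⌋ ∧ not ⌊ a ≟ c ⌋ ∧ not ⌊ a ≟ d ⌋ ∧
  not ⌊ b ≟ c ⌋ ∧ not ⌊ b ≟ d ⌋ ∧ not ⌊ c ≟ d ⌋

detTensor : Fin 4 → Fin 4 → Fin 4 → Fin 4 → F₂
detTensor = distinct4

IsRank1Decomp : (r : ℕ) → (Fin r → Mat4 × Mat4) → Set
IsRank1Decomp r AB =
  (∀ i → IsRank1 (proj₁ (AB i)) × IsRank1 (proj₂ (AB i))) ×
  (∀ a b c d → detTensor a b c d ≡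
     Σ₂ r (λ i → proj₁ (AB i) a b ∧ proj₂ (AB i) c d))

IsMinimalDecomp : (r : ℕ) → (Fin r → Mat4 × Mat4) → Set
IsMinimalDecomp r AB =
  IsRank1Decomp r AB ×
  (∀ (s : ℕ) (CD : Fin s → Mat4 × Mat4) → IsRank1Decomp s CD → r ≤ s)

{-# OPTIONS --safe #-}
-- Contracting det⁴ with u and v in its first two factors gives the matrix
-- C_cd = Σ_ab u_a v_b det⁴_abcd, which is alternating (zero diagonal,
-- symmetric) because det⁴ is.  Contracting a decomposition instead gives
-- C = Σ_i (uᵀ A_i v) B_i, so if exactly one coefficient is 1, say at i₀, then
-- C = B_i₀ = x yᵀ with x, y ≠ 0; but no such outer product is alternating: x_j = y_k = 1
-- forces x_k = 0 by C_kk = 0, and then C_jk = 1 ≠ 0 = C_kj.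
module Submission where

open import Defs
open import Data.Nat using (ℕ; zero; suc; pred)
open import Data.Fin using (Fin; zero; suc)
open import Data.Fin.Properties using (all?)
open import Data.Bool using (true; false; _∧_; _xor_)
open import Data.Bool.Properties using (∧-comm; ∧-identityʳ; xor-identityʳ; xor-∧-commutativeRing)
  renaming (_≟_ to _≟ᵇ_)
open import Data.Product using (_×_; _,_; proj₁; proj₂; ∃)
open import Algebra.Bundles using (CommutativeRing)
open import Algebra.Properties.Semiring.Sum (CommutativeRing.semiring xor-∧-commutativeRing)
  using (sum; sum-syntax; sum-cong-≗; *-distribˡ-sum; *-distribʳ-sum)
open import Algebra.Properties.CommutativeMonoid.Sum
  (CommutativeRing.+-commutativeMonoid xor-∧-commutativeRing) using (∑-comm)
open import Function using (_∘_; case_of_)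
open import Relation.Nullary using (¬_)
open import Relation.Nullary.Decidable using (toWitness)
open import Relation.Binary.PropositionalEquality

Σ₂≡sum : ∀ n (f : Fin n → F₂) → Σ₂ n f ≡ sum f
Σ₂≡sum zero    f = refl
Σ₂≡sum (suc n) f = cong (f zero xor_) (Σ₂≡sum n (λ i → f (suc i)))

count≡0⇒Σ₂-∧≡false : ∀ n (g h : Fin n → F₂) → count n g ≡ 0 →
  Σ₂ n (λ i → g i ∧ h i) ≡ false
count≡0⇒Σ₂-∧≡false zero    g h _ = refl
count≡0⇒Σ₂-∧≡false (suc n) g h e with g zero | e
... | false | e′ = count≡0⇒Σ₂-∧≡false n (λ i → g (suc i)) (λ i → h (suc i)) e′
... | true  | ()

count≡1⇒Σ₂-∧-selects : ∀ n (g : Fin n → F₂) → count n g ≡ 1 →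
  ∃ λ i₀ → ∀ (h : Fin n → F₂) → Σ₂ n (λ i → g i ∧ h i) ≡ h i₀
count≡1⇒Σ₂-∧-selects zero    g ()
count≡1⇒Σ₂-∧-selects (suc n) g e with g zero | e
... | true | e′ = zero , λ h → begin
  h zero xor Σ₂ n (λ i → g (suc i) ∧ h (suc i))
    ≡⟨ cong (h zero xor_) (count≡0⇒Σ₂-∧≡false n _ _ (cong pred e′)) ⟩
  h zero xor false
    ≡⟨ xor-identityʳ (h zero) ⟩
  h zero ∎
  where open ≡-Reasoning
... | false | e′ with count≡1⇒Σ₂-∧-selects n (λ i → g (suc i)) e′
... | i₀ , selects = suc i₀ , λ h → selects (λ i → h (suc i))

∧-move-middle-right : ∀ u a b v → u ∧ ((a ∧ b) ∧ v) ≡ (u ∧ (a ∧ v)) ∧ b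
∧-move-middle-right false a     b v = refl
∧-move-middle-right true  false b v = refl
∧-move-middle-right true  true  b v = ∧-comm b v

bil-cong : ∀ u v {M N : Mat4} → (∀ j k → M j k ≡ N j k) → bil u M v ≡ bil u N v
bil-cong u v M≗N = sum-cong-≗ λ j → sum-cong-≗ λ k → cong (λ m → u j ∧ (m ∧ v k)) (M≗N j k)

-- At the literal size 4, Σ₂ and sum unfold to the same term, so bil u M v is
-- ∑[ j < 4 ] ∑[ k < 4 ] (u j ∧ (M j k ∧ v k)) definitionally.
bil-linear : ∀ u v {r} (A : Fin r → Mat4) (β : Fin r → F₂) →
  bil u (λ j k → Σ₂ r (λ i → A i j k ∧ β i)) v ≡ Σ₂ r (λ i → bil u (A i) v ∧ β i)
bil-linear u v {r} A β = begin
  ∑[ j < 4 ] ∑[ k < 4 ] (u j ∧ (Σ₂ r (λ i → A i j k ∧ β i) ∧ v k))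
    ≡⟨ sum-cong-≗ (λ j → sum-cong-≗ λ k → entry j k) ⟩
  ∑[ j < 4 ] ∑[ k < 4 ] ∑[ i < r ] ((u j ∧ (A i j k ∧ v k)) ∧ β i)
    ≡⟨ sum-cong-≗ (λ j → ∑-comm (λ k i → (u j ∧ (A i j k ∧ v k)) ∧ β i)) ⟩
  ∑[ j < 4 ] ∑[ i < r ] ∑[ k < 4 ] ((u j ∧ (A i j k ∧ v k)) ∧ β i)
    ≡⟨ ∑-comm (λ j i → ∑[ k < 4 ] ((u j ∧ (A i j k ∧ v k)) ∧ β i)) ⟩
  ∑[ i < r ] ∑[ j < 4 ] ∑[ k < 4 ] ((u j ∧ (A i j k ∧ v k)) ∧ β i)
    ≡⟨ sum-cong-≗ (λ i → pull-out i) ⟨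
  ∑[ i < r ] (bil u (A i) v ∧ β i)
    ≡⟨ Σ₂≡sum r _ ⟨
  Σ₂ r (λ i → bil u (A i) v ∧ β i) ∎
  where
  open ≡-Reasoning

  entry : ∀ j k → u j ∧ (Σ₂ r (λ i → A i j k ∧ β i) ∧ v k)
                ≡ ∑[ i < r ] ((u j ∧ (A i j k ∧ v k)) ∧ β i)
  entry j k = begin
    u j ∧ (Σ₂ r (λ i → A i j k ∧ β i) ∧ v k)
      ≡⟨ cong (λ s → u j ∧ (s ∧ v k)) (Σ₂≡sum r _) ⟩
    u j ∧ (∑[ i < r ] (A i j k ∧ β i) ∧ v k)
      ≡⟨ cong (u j ∧_) (*-distribʳ-sum (v k) (λ i → A i j k ∧ β i)) ⟩
    u j ∧ ∑[ i < r ] ((A i j k ∧ β i) ∧ v k)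
      ≡⟨ *-distribˡ-sum (u j) (λ i → (A i j k ∧ β i) ∧ v k) ⟩
    ∑[ i < r ] (u j ∧ ((A i j k ∧ β i) ∧ v k))
      ≡⟨ sum-cong-≗ (λ i → ∧-move-middle-right (u j) (A i j k) (β i) (v k)) ⟩
    ∑[ i < r ] ((u j ∧ (A i j k ∧ v k)) ∧ β i) ∎

  pull-out : ∀ i → bil u (A i) v ∧ β i
                 ≡ ∑[ j < 4 ] ∑[ k < 4 ] ((u j ∧ (A i j k ∧ v k)) ∧ β i)
  pull-out i = trans (*-distribʳ-sum (β i) (λ j → ∑[ k < 4 ] (u j ∧ (A i j k ∧ v k))))
                     (sum-cong-≗ λ j → *-distribʳ-sum (β i) (λ k → u j ∧ (A i j k ∧ v k)))

bil-zeroMatrix : ∀ u v → bil u (λ _ _ → false) v ≡ false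
bil-zeroMatrix u v = bil-linear u v {r = 0} (λ ()) (λ ())

IsAlternating : Mat4 → Set
IsAlternating M = (∀ c → M c c ≡ false) × (∀ c d → M c d ≡ M d c)

IsAlternating-resp : ∀ {M N : Mat4} → (∀ c d → M c d ≡ N c d) →
  IsAlternating M → IsAlternating N
IsAlternating-resp M≗N (diag , symm) =
    (λ c → trans (sym (M≗N c c)) (diag c))
  , (λ c d → trans (sym (M≗N c d)) (trans (symm c d) (M≗N d c)))

outer-not-alternating : ∀ x y → NonZeroVec x → NonZeroVec y → ¬ IsAlternating (outer x y)
outer-not-alternating x y (j , xⱼ≡1) (k , yₖ≡1) (diag , symm) = case true≡false of λ ()
  where
  open ≡-Reasoning

  xₖ≡0 : x k ≡ false
  xₖ≡0 = begin
    x k          ≡⟨ ∧-identityʳ (x k) ⟨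
    x k ∧ true   ≡⟨ cong (x k ∧_) yₖ≡1 ⟨
    x k ∧ y k    ≡⟨ diag k ⟩
    false        ∎

  true≡false : true ≡ false
  true≡false = begin
    true         ≡⟨ cong₂ _∧_ xⱼ≡1 yₖ≡1 ⟨
    x j ∧ y k    ≡⟨ symm j k ⟩
    x k ∧ y j    ≡⟨ cong (_∧ y j) xₖ≡0 ⟩
    false        ∎

Tensor4 : Set
Tensor4 = Fin 4 → Fin 4 → Fin 4 → Fin 4 → F₂

contract : Vec4 → Vec4 → Tensor4 → Mat4
contract u v T c d = bil u (λ a b → T a b c d) v

contract-alternating : ∀ u v (T : Tensor4) →
  (∀ a b c → T a b c c ≡ false) → (∀ a b c d → T a b c d ≡ T a b d c) →
  IsAlternating (contract u v T)
contract-alternating u v T diag symm =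
    (λ c → trans (bil-cong u v (λ a b → diag a b c)) (bil-zeroMatrix u v))
  , (λ c d → bil-cong u v (λ a b → symm a b c d))

contract-decomp : ∀ u v (T : Tensor4) {r} (A B : Fin r → Mat4) →
  (∀ a b c d → T a b c d ≡ Σ₂ r (λ i → A i a b ∧ B i c d)) →
  ∀ c d → contract u v T c d ≡ Σ₂ r (λ i → bil u (A i) v ∧ B i c d)
contract-decomp u v T A B T≡ΣA⊗B c d =
  trans (bil-cong u v (λ a b → T≡ΣA⊗B a b c d)) (bil-linear u v A (λ i → B i c d))

distinct4-diag : ∀ a b c → distinct4 a b c c ≡ false
distinct4-diag = toWitness {a? = all? λ a → all? λ b → all? λ c →
                                 distinct4 a b c c ≟ᵇ false} _

distinct4-swap : ∀ a b c d → distinct4 a b c d ≡ distinct4 a b d c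
distinct4-swap = toWitness {a? = all? λ a → all? λ b → all? λ c → all? λ d →
                                 distinct4 a b c d ≟ᵇ distinct4 a b d c} _

lemmaB1 : (r : ℕ) (AB : Fin r → Mat4 × Mat4) → IsMinimalDecomp r AB →
    (u v : Vec4) → NonZeroVec u → NonZeroVec v →
    count r (λ i → bil u (proj₁ (AB i)) v) ≢ 1
lemmaB1 r AB ((rank1 , decomp) , _) u v _ _ count≡1
  with count≡1⇒Σ₂-∧-selects r (λ i → bil u (proj₁ (AB i)) v) count≡1
... | i₀ , selects with proj₂ (rank1 i₀)
... | x , y , x≢0 , y≢0 , Bᵢ₀≡xy =
  outer-not-alternating x y x≢0 y≢0
    (IsAlternating-resp C≡xy (contract-alternating u v detTensor distinct4-diag distinct4-swap))
  where
  C≡xy : ∀ c d → contract u v detTensor c d ≡ outer x y c d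
  C≡xy c d = begin
    contract u v detTensor c d
      ≡⟨ contract-decomp u v detTensor (proj₁ ∘ AB) (proj₂ ∘ AB) decomp c d ⟩
    Σ₂ r (λ i → bil u (proj₁ (AB i)) v ∧ proj₂ (AB i) c d)
      ≡⟨ selects (λ i → proj₂ (AB i) c d) ⟩
    proj₂ (AB i₀) c d
      ≡⟨ Bᵢ₀≡xy c d ⟩
    outer x y c d ∎
    where open ≡-Reasoning
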